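{- Let $n\in\mathbb N$ and $B\subseteq[n]$ with $B=10B'$ for a $3$-AP-free set $B'$. Then the hypergraph $\mathcal H'_B(n)$ is induced $K_5^-$-free.
   Context: Let $X=\{x_0,\dots,x_n\}$, $Y=\{y_0,\dots,y_n\}$, $Z=\{z_0,\dots,z_n\}$ be pairwise disjoint. For $b\in[n]$ let $E_{i,b}=\{x_i,x_{i+1},y_{i+b},z_{i+2b},z_{i+2b+1}\}$ and $\mathcal H_b(n)=\{E_{i,b}:0\leq i\leq n-2b-1\}$. A chain of length $k$ is the $5$-uniform hypergraph on an ordered set of distinct vertices $w_1,\dots,w_{3k+2}$ with edges $\{w_{3i-2},\dots,w_{3i+2}\}$, $i\in[k]$. Write $B=\{b_1<\dots<b_t\}$ and $f^j_b=\{x_j,z_{j+2b}\}$. Set $s_1=0$, $\ell_1=n-2b_1$ and $\mathcal H'_{b_1}(n)=\mathcal H_{b_1}(n)$. For $2\leq j\leq t$, choose integers $s_j$ and $\ell_j\leq n-2b_j$ with $\ell_j-s_j$ maximal subject to $(f^{s_j}_{b_j}\cup f^{\ell_j}_{b_j})\cap\bigcup_{i=1}^{j-1}(f^{s_i}_{b_i}\cup f^{\ell_i}_{b_i})=\emptyset$, and let $\mathcal H'_{b_j}(n)=\{E_{i,b_j}: s_j\leq i\leq \ell_j-1\}$. Let $U_1,\dots,U_{t-1}$ be pairwise disjoint new sets of $7$ vertices each (disjoint from $X\cup Y\cup Z$), and for $i\in[t-1]$ let $\mathcal D_i$ be a chain of length $3$ on the vertex set $f^{\ell_i}_{b_i}\cup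 U_i\cup f^{s_{i+1}}_{b_{i+1}}$ whose ordering starts with the two vertices of $f^{\ell_i}_{b_i}$ and ends with the two vertices of $f^{s_{i+1}}_{b_{i+1}}$. Define $\mathcal H'_B(n)=\bigcup_{j=1}^t\mathcal H'_{b_j}(n)\cup\bigcup_{i=1}^{t-1}\mathcal D_i$. A set of integers $B'$ is $3$-AP-free if $b_1,b_2,b_3\in B'$ with $2b_1=b_2+b_3$ implies $b_1=b_2=b_3$; $10B'=\{10b:b\in B'\}$. The $2$-skeleton of a hypergraph is the graph on its vertex set in which two vertices are adjacent iff they lie in a common edge. $K_5^-$ is $K_5$ minus one edge. A hypergraph is induced $K_5^-$-free if the vertex set of every copy of $K_5^-$ in its $2$-skeleton is contained in an edge of the hypergraph. -}

module Defs where

open import Data.Nat using (ℕ; suc; _+_; _*_; _≤_; _<_)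
open import Data.Fin using (Fin; #_; toℕ)
open import Data.Vec using (Vec; _∷_; [])
open import Data.Vec.Membership.Propositional using (_∈_)
open import Data.Product using (Σ; ∃; _×_)
open import Data.Sum using (_⊎_)
open import Data.Empty using (⊥)
open import Relation.Nullary using (¬_)
open import Relation.Binary.PropositionalEquality using (_≡_)
open import Function.Definitions using (Injective)

-- Generic notions for 5-uniform hypergraphs.
-- A 5-uniform hypergraph on vertex type W is given by a predicate on
-- 5-vertex lists (an edge is the set of the 5 listed vertices).

Hypergraph5 : Set → Set₁
Hypergraph5 W = Vec W 5 → Set

Adj2 : {W : Set} → Hypergraph5 W → W → W → Set
Adj2 H a c = ¬ (a ≡ c) × ∃ λ e → H e × a ∈ e × c ∈ e

IsK5MinusCopy : {W : Set} → Hypergraph5 W → (Fin 5 → W) → Set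
IsK5MinusCopy H v =
  Injective _≡_ _≡_ v ×
  (∀ i j → toℕ i < toℕ j → ¬ (toℕ i ≡ 3 × toℕ j ≡ 4) → Adj2 H (v i) (v j))

InducedK5MinusFree : {W : Set} → Hypergraph5 W → Set
InducedK5MinusFree H =
  ∀ (v : Fin 5 → _) → IsK5MinusCopy H v → ∃ λ e → H e × (∀ i → v i ∈ e)

-- The vertex set: x_i, y_i, z_i and the new vertices u j m (m ∈ Fin 7)
-- forming U_j (0-indexed j; U_j sits between the j-th and (j+1)-th
-- element of B, in 0-indexed numbering).

data V : Set where
  x : ℕ → V
  y : ℕ → V
  z : ℕ → V
  u : ℕ → Fin 7 → V

E : ℕ → ℕ → Vec V 5
E i b = x i ∷ x (suc i) ∷ y (i + b) ∷ z (i + 2 * b) ∷ z (suc (i + 2 * b)) ∷ []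

InF : ℕ → ℕ → V → Set
InF b s v = v ≡ x s ⊎ v ≡ z (s + 2 * b)

ChainEdge : (Fin 11 → V) → Vec V 5 → Set
ChainEdge w e =
  e ≡ (w (# 0) ∷ w (# 1) ∷ w (# 2) ∷ w (# 3) ∷ w (# 4) ∷ []) ⊎
  (e ≡ (w (# 3) ∷ w (# 4) ∷ w (# 5) ∷ w (# 6) ∷ w (# 7) ∷ []) ⊎
   e ≡ (w (# 6) ∷ w (# 7) ∷ w (# 8) ∷ w (# 9) ∷ w (# 10) ∷ []))

-- The construction.  B = {b 0 < ... < b (t-1)} (0-indexed), with the
-- chosen endpoints s j, ℓ j and the chain orderings w j (for j+1 < t).

Admissible : (n : ℕ) (b s ℓ : ℕ → ℕ) (j s' ℓ' : ℕ) → Set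
Admissible n b s ℓ j s' ℓ' =
  s' + 2 * b j ≤ n × ℓ' + 2 * b j ≤ n ×
  (∀ i → i < j → ∀ v → (InF (b j) s' v ⊎ InF (b j) ℓ' v) →
     (InF (b i) (s i) v ⊎ InF (b i) (ℓ i) v) → ⊥)

EndpointsChosen : (n t : ℕ) (b s ℓ : ℕ → ℕ) → Set
EndpointsChosen n t b s ℓ =
  (0 < t → s 0 ≡ 0 × ℓ 0 + 2 * b 0 ≡ n) ×
  (∀ j → 1 ≤ j → j < t →
     Admissible n b s ℓ j (s j) (ℓ j) ×
     (∀ s' ℓ' → Admissible n b s ℓ j s' ℓ' → ℓ' + s j ≤ ℓ j + s'))

ChainsChosen : (t : ℕ) (b s ℓ : ℕ → ℕ) (w : ℕ → Fin 11 → V) → Set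
ChainsChosen t b s ℓ w =
  ∀ j → suc j < t →
    Injective _≡_ _≡_ (w j) ×
    ((w j (# 0) ≡ x (ℓ j) × w j (# 1) ≡ z (ℓ j + 2 * b j)) ⊎
     (w j (# 1) ≡ x (ℓ j) × w j (# 0) ≡ z (ℓ j + 2 * b j))) ×
    ((w j (# 9) ≡ x (s (suc j)) × w j (# 10) ≡ z (s (suc j) + 2 * b (suc j))) ⊎
     (w j (# 10) ≡ x (s (suc j)) × w j (# 9) ≡ z (s (suc j) + 2 * b (suc j)))) ×
    (∀ (k : Fin 11) → 2 ≤ toℕ k → toℕ k ≤ 8 → ∃ λ m → w j k ≡ u j m)

H'B : (t : ℕ) (b s ℓ : ℕ → ℕ) (w : ℕ → Fin 11 → V) → Hypergraph5 V
H'B t b s ℓ w e =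
  (∃ λ j → j < t × ∃ λ i → s j ≤ i × suc i ≤ ℓ j × e ≡ E i (b j)) ⊎
  (∃ λ j → suc j < t × ChainEdge (w j) e)

ThreeAPFree : (t : ℕ) (b' : ℕ → ℕ) → Set
ThreeAPFree t b' =
  ∀ i j k → i < t → j < t → k < t →
    2 * b' i ≡ b' j + b' k → b' i ≡ b' j × b' j ≡ b' k

module Submission where

-- Every vertex carries a coordinate (the index of x_i, y_i or z_i), and along an
-- adjacency the coordinate grows by 0, b or 2b up to unit corrections (an Offset).
-- Around a triangle of the 2-skeleton the offsets add up, so b₁ + b₂ and 2b₃
-- differ by less than 10; since B = 10B′ with B′ 3-AP-free, the three b's
-- coincide and the unit corrections balance, which puts the triangle into a
-- single edge E_{i,b}.  The same computation shows that a vertex adjacent to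
-- both ends of a rigid pair of positions of an edge lies in that edge, and any
-- three positions of an edge contain a rigid pair.  The new vertices U_j only
-- lie in the chain D_j and are handled by a finite check on the eleven
-- positions of a chain of length 3.  For a copy v₀ … v₄ of K₅⁻, the triangle
-- v₀v₁v₂ lies in an edge e, and v₃, v₄, adjacent to all of v₀, v₁, v₂, lie in e.

open import Defs
open import Data.Nat using (ℕ; suc; _+_; _*_; _≤_; _<_; _≤?_; _<?_; z≤n; s≤s; NonZero) renaming (_≟_ to _≟ℕ_)
open import Data.Nat.Properties hiding (_≟_)
open import Data.Nat.DivMod using (_%_; [m+kn]%n≡m%n; m<n⇒m%n≡m)
open import Data.Nat.Tactic.RingSolver using (solve-∀)
open import Data.Fin using (Fin; suc; toℕ; _≟_)
open import Data.Fin.Patterns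
open import Data.Fin.Properties using (all?; any?)
open import Data.Vec using (Vec; _∷_; []; map; lookup)
open import Data.Vec.Relation.Unary.Any using (here; there; index)
open import Data.Vec.Relation.Unary.Any.Properties using (map⁻; lookup-index)
open import Data.Vec.Membership.Propositional using (_∈_; find)
open import Data.Vec.Membership.Propositional.Properties using (∈-map⁺)
open import Data.Vec.Membership.DecPropositional using () renaming (_∈?_ to member?)
open import Data.Product using (∃; ∃₂; _×_; _,_; proj₁; proj₂)
open import Data.Product.Properties using (≡-dec)
open import Data.Sum using (_⊎_; inj₁; inj₂)
open import Data.Empty using (⊥; ⊥-elim)
open import Function using (_∘_)
open import Relation.Nullary using (Dec; no; ¬_; ¬?)
open import Relation.Nullary.Decidable
  using (_×-dec_; _⊎-dec_; _→-dec_; from-yes; map′; True; False; toWitness; toWitnessFalse)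
open import Relation.Binary.PropositionalEquality
open ≡-Reasoning

-- Offsets

remainder-quotient-unique : ∀ {n r r′ q q′} .{{_ : NonZero n}} → r < n → r′ < n →
  r + q * n ≡ r′ + q′ * n → r ≡ r′ × q ≡ q′
remainder-quotient-unique {n} {r} {r′} {q} {q′} r<n r′<n eq =
  r≡r′ , *-cancelʳ-≡ q q′ n (+-cancelˡ-≡ r _ _ (trans eq (cong (_+ q′ * n) (sym r≡r′))))
  where
  r≡r′ : r ≡ r′
  r≡r′ = begin
    r                 ≡⟨ sym (m<n⇒m%n≡m r<n) ⟩
    r % n             ≡⟨ sym ([m+kn]%n≡m%n r q n) ⟩
    (r + q * n) % n   ≡⟨ cong (_% n) eq ⟩
    (r′ + q′ * n) % n ≡⟨ [m+kn]%n≡m%n r′ q′ n ⟩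
    r′ % n            ≡⟨ m<n⇒m%n≡m r′<n ⟩
    r′                ∎

record Offset (p q B : ℕ) : Set where
  constructor offset
  field
    δ⁻ δ⁺ : ℕ
    δ⁻≤1 : δ⁻ ≤ 1
    δ⁺≤1 : δ⁺ ≤ 1
    shift : δ⁻ + q ≡ δ⁺ + (p + B)

open Offset

Balanced : ∀ {p q r B₁ B₂ B₃} → Offset p q B₁ → Offset q r B₂ → Offset p r B₃ → Set
Balanced o₁ o₂ o₃ = δ⁺ o₁ + δ⁺ o₂ + δ⁻ o₃ ≡ δ⁻ o₁ + δ⁻ o₂ + δ⁺ o₃

offset-triangle : ∀ {p q r B₁ B₂ B₃} (o₁ : Offset p q B₁) (o₂ : Offset q r B₂) (o₃ : Offset p r B₃) →
  δ⁺ o₁ + δ⁺ o₂ + δ⁻ o₃ + (B₁ + B₂) ≡ δ⁻ o₁ + δ⁻ o₂ + δ⁺ o₃ + B₃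
offset-triangle {p} {q} {r} {B₁} {B₂} {B₃}
                (offset a₁ b₁ _ _ e₁) (offset a₂ b₂ _ _ e₂) (offset a₃ b₃ _ _ e₃) =
  +-cancelˡ-≡ (p + q + r) _ _ (begin
    p + q + r + (b₁ + b₂ + a₃ + (B₁ + B₂))       ≡⟨ gather p q r b₁ b₂ a₃ B₁ B₂ ⟩
    (b₁ + (p + B₁)) + (b₂ + (q + B₂)) + (a₃ + r) ≡⟨ cong₂ _+_ (cong₂ _+_ (sym e₁) (sym e₂)) e₃ ⟩
    (a₁ + q) + (a₂ + r) + (b₃ + (p + B₃))        ≡⟨ scatter p q r a₁ a₂ b₃ B₃ ⟩
    p + q + r + (a₁ + a₂ + b₃ + B₃)              ∎)
  where
  gather : ∀ p q r s₁ s₂ s₃ B B′ →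
    p + q + r + (s₁ + s₂ + s₃ + (B + B′)) ≡ (s₁ + (p + B)) + (s₂ + (q + B′)) + (s₃ + r)
  gather = solve-∀
  scatter : ∀ p q r s₁ s₂ s₃ B → (s₁ + q) + (s₂ + r) + (s₃ + (p + B)) ≡ p + q + r + (s₁ + s₂ + s₃ + B)
  scatter = solve-∀

three-units<10 : ∀ {a b c} → a ≤ 1 → b ≤ 1 → c ≤ 1 → a + b + c < 10
three-units<10 a≤1 b≤1 c≤1 = s≤s (≤-trans (+-mono-≤ (+-mono-≤ a≤1 b≤1) c≤1) (m≤m+n 3 6))

offset-triangle-tens : ∀ {p q r B₁ B₂ B₃ c c′} → B₁ + B₂ ≡ c * 10 → B₃ ≡ c′ * 10 →
  (o₁ : Offset p q B₁) (o₂ : Offset q r B₂) (o₃ : Offset p r B₃) → Balanced o₁ o₂ o₃ × c ≡ c′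
offset-triangle-tens eq₁₂ eq₃ o₁ o₂ o₃ =
  remainder-quotient-unique
    (three-units<10 (δ⁺≤1 o₁) (δ⁺≤1 o₂) (δ⁻≤1 o₃)) (three-units<10 (δ⁻≤1 o₁) (δ⁻≤1 o₂) (δ⁺≤1 o₃))
    (subst₂ (λ X Y → δ⁺ o₁ + δ⁺ o₂ + δ⁻ o₃ + X ≡ δ⁻ o₁ + δ⁻ o₂ + δ⁺ o₃ + Y) eq₁₂ eq₃
            (offset-triangle o₁ o₂ o₃))

successor-offset : ∀ {a a′} → suc a ≡ a′ → Offset a a′ 0
successor-offset {a} a+1≡a′ = offset 0 1 z≤n ≤-refl (trans (sym a+1≡a′) (cong suc (sym (+-identityʳ a))))

m+2n≡m+n+n : ∀ m n → m + 2 * n ≡ m + n + n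
m+2n≡m+n+n = solve-∀

same-start : ∀ {i i′ B B′} → i + B ≡ i′ + B′ → B′ ≡ B → i ≡ i′
same-start {i} {i′} {B} eq B′≡B = +-cancelʳ-≡ B i i′ (trans eq (cong (i′ +_) B′≡B))

x₀y-offset : ∀ {i} B → Offset i (i + B) B
x₀y-offset _ = offset 0 0 z≤n z≤n refl

x₁y-offset : ∀ {i} B → Offset (suc i) (i + B) B
x₁y-offset _ = offset 1 0 ≤-refl z≤n refl

x₀z₁-offset : ∀ {i} B → Offset i (suc (i + 2 * B)) (2 * B)
x₀z₁-offset _ = offset 0 1 z≤n ≤-refl refl

x₁z₀-offset : ∀ {i} B → Offset (suc i) (i + 2 * B) (2 * B)
x₁z₀-offset _ = offset 1 0 ≤-refl z≤n refl

yz₀-offset : ∀ {i} B → Offset (i + B) (i + 2 * B) B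
yz₀-offset {i} B = offset 0 0 z≤n z≤n (m+2n≡m+n+n i B)

yz₁-offset : ∀ {i} B → Offset (i + B) (suc (i + 2 * B)) B
yz₁-offset {i} B = offset 0 1 z≤n ≤-refl (cong suc (m+2n≡m+n+n i B))

2+≢unit : ∀ {m r} → r ≤ 1 → 2 + m ≢ r
2+≢unit z≤n ()
2+≢unit (s≤s z≤n) ()

units-suc-split : ∀ {α β γ δ} → α ≤ 1 → β ≤ 1 → γ ≤ 1 → δ ≤ 1 →
  suc (α + β) ≡ γ + δ → β ≡ 0 × δ ≡ 1 ⊎ γ ≡ 1 × α ≡ 0
units-suc-split z≤n       z≤n       z≤n       z≤n       ()
units-suc-split z≤n       z≤n       z≤n       (s≤s z≤n) refl = inj₁ (refl , refl)
units-suc-split z≤n       z≤n       (s≤s z≤n) z≤n       refl = inj₂ (refl , refl)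
units-suc-split z≤n       z≤n       (s≤s z≤n) (s≤s z≤n) ()
units-suc-split z≤n       (s≤s z≤n) z≤n       z≤n       ()
units-suc-split z≤n       (s≤s z≤n) z≤n       (s≤s z≤n) ()
units-suc-split z≤n       (s≤s z≤n) (s≤s z≤n) z≤n       ()
units-suc-split z≤n       (s≤s z≤n) (s≤s z≤n) (s≤s z≤n) refl = inj₂ (refl , refl)
units-suc-split (s≤s z≤n) z≤n       z≤n       z≤n       ()
units-suc-split (s≤s z≤n) z≤n       z≤n       (s≤s z≤n) ()
units-suc-split (s≤s z≤n) z≤n       (s≤s z≤n) z≤n       ()
units-suc-split (s≤s z≤n) z≤n       (s≤s z≤n) (s≤s z≤n) refl = inj₁ (refl , refl)
units-suc-split (s≤s z≤n) (s≤s z≤n) z≤n       z≤n       ()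
units-suc-split (s≤s z≤n) (s≤s z≤n) z≤n       (s≤s z≤n) ()
units-suc-split (s≤s z≤n) (s≤s z≤n) (s≤s z≤n) z≤n       ()
units-suc-split (s≤s z≤n) (s≤s z≤n) (s≤s z≤n) (s≤s z≤n) ()

m+1+n≡o+0+p⇒suc[m+n]≡o+p : ∀ {m n o p} → m + 1 + n ≡ o + 0 + p → suc (m + n) ≡ o + p
m+1+n≡o+0+p⇒suc[m+n]≡o+p {m} {n} {o} {p} eq = trans (cong (_+ n) (+-comm 1 m)) (trans eq (cong (_+ p) (+-identityʳ o)))

-- A pair of positions is rigid when every common neighbour of its two vertices
-- lies in the edge.  The remaining pairs {0,1}, {0,3}, {1,4}, {3,4} form a
-- 4-cycle, so any three positions contain a rigid pair.
rigidPairs : Vec (Fin 5 × Fin 5) 6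
rigidPairs = (0F , 2F) ∷ (0F , 4F) ∷ (1F , 2F) ∷ (1F , 3F) ∷ (2F , 3F) ∷ (2F , 4F) ∷ []

pattern x₀y-pair  = here refl
pattern x₀z₁-pair = there (here refl)
pattern x₁y-pair  = there (there (here refl))
pattern x₁z₀-pair = there (there (there (here refl)))
pattern yz₀-pair  = there (there (there (there (here refl))))
pattern yz₁-pair  = there (there (there (there (there (here refl)))))

Rigid : Fin 5 → Fin 5 → Set
Rigid k k′ = (k , k′) ∈ rigidPairs ⊎ (k′ , k) ∈ rigidPairs

rigid? : ∀ k k′ → Dec (Rigid k k′)
rigid? k k′ = member? (≡-dec _≟_ _≟_) (k , k′) rigidPairs ⊎-dec member? (≡-dec _≟_ _≟_) (k′ , k) rigidPairs

-- The finite facts are proved by evaluating a decision procedure; they are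
-- opaque so that this evaluation is not repeated wherever they are used.
opaque
  three-positions-contain-rigid-pair : ∀ {ka kc kd} → ka ≢ kc → ka ≢ kd → kc ≢ kd →
    Rigid ka kc ⊎ Rigid ka kd ⊎ Rigid kc kd
  three-positions-contain-rigid-pair {ka} {kc} {kd} = from-yes (all? λ ka → all? λ kc → all? λ kd →
    ¬? (ka ≟ kc) →-dec ¬? (ka ≟ kd) →-dec ¬? (kc ≟ kd) →-dec
    (rigid? ka kc ⊎-dec rigid? ka kd ⊎-dec rigid? kc kd)) ka kc kd

-- Positions 0 … 10 of a chain of length 3; its edges are the blocks 0–4, 3–7
-- and 6–10.  In D_j the inner positions carry U_j and the head and tail carry
-- f^{ℓ_j}_{b_j} and f^{s_{j+1}}_{b_{j+1}}.
pattern 10F = suc 9F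

blockIndices : Fin 3 → Vec (Fin 11) 5
blockIndices 0F = 0F ∷ 1F ∷ 2F ∷ 3F ∷ 4F ∷ []
blockIndices 1F = 3F ∷ 4F ∷ 5F ∷ 6F ∷ 7F ∷ []
blockIndices 2F = 6F ∷ 7F ∷ 8F ∷ 9F ∷ 10F ∷ []

-- Membership of a block by bounds: deciding it is far cheaper than searching blockIndices.
record InBlock (β : Fin 3) (k : Fin 11) : Set where
  constructor in-block
  field
    bounds : 3 * toℕ β ≤ toℕ k × toℕ k ≤ 3 * toℕ β + 4

inBlock? : ∀ β k → Dec (InBlock β k)
inBlock? β k = map′ in-block InBlock.bounds ((3 * toℕ β ≤? toℕ k) ×-dec (toℕ k ≤? 3 * toℕ β + 4))

opaque
  InBlock⇒∈ : ∀ {β k} → InBlock β k → k ∈ blockIndices β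
  InBlock⇒∈ {β} {k} = from-yes (all? λ β → all? λ k → inBlock? β k →-dec member? _≟_ k (blockIndices β)) β k

  ∈⇒InBlock : ∀ {β k} → k ∈ blockIndices β → InBlock β k
  ∈⇒InBlock {β} {k} = from-yes (all? λ β → all? λ k → member? _≟_ k (blockIndices β) →-dec inBlock? β k) β k

SameBlock : Fin 11 → Fin 11 → Set
SameBlock k k′ = ∃ λ β → InBlock β k × InBlock β k′

sameBlock? : ∀ k k′ → Dec (SameBlock k k′)
sameBlock? k k′ = any? λ β → inBlock? β k ×-dec inBlock? β k′

Inner : Fin 11 → Set
Inner k = 2 ≤ toℕ k × toℕ k ≤ 8

inner? : ∀ k → Dec (Inner k)
inner? k = (2 ≤? toℕ k) ×-dec (toℕ k ≤? 8)

Head Tail Outer : Fin 11 → Set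
Head k = k ∈ 0F ∷ 1F ∷ []
Tail k = k ∈ 9F ∷ 10F ∷ []
Outer k = Head k ⊎ Tail k

head? : ∀ k → Dec (Head k)
head? k = member? _≟_ k (0F ∷ 1F ∷ [])
tail? : ∀ k → Dec (Tail k)
tail? k = member? _≟_ k (9F ∷ 10F ∷ [])
outer? : ∀ k → Dec (Outer k)
outer? k = head? k ⊎-dec tail? k

-- Two vertices of a chain can only be adjacent if their positions are linked:
-- outer vertices may also be adjacent through edges of the H'_{b_j}.
Linked : Fin 11 → Fin 11 → Set
Linked k k′ = SameBlock k k′ ⊎ (Outer k × Outer k′)

linked? : ∀ k k′ → Dec (Linked k k′)
linked? k k′ = sameBlock? k k′ ⊎-dec (outer? k ×-dec outer? k′)

opaque
  inner-or-outer : ∀ k → Inner k ⊎ Outer k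
  inner-or-outer k = from-yes (all? λ k → inner? k ⊎-dec outer? k) k

  outer-pair-in-block : ∀ {k k′} → SameBlock k k′ → Outer k → Outer k′ →
    Head k × Head k′ ⊎ Tail k × Tail k′
  outer-pair-in-block {k} {k′} = from-yes (all? λ k → all? λ k′ →
    sameBlock? k k′ →-dec outer? k →-dec outer? k′ →-dec
    (head? k ×-dec head? k′ ⊎-dec tail? k ×-dec tail? k′)) k k′

  triangle-through-inner-in-block : ∀ {k₀ k₁ k₂} → Inner k₀ → Linked k₀ k₁ → Linked k₀ k₂ → Linked k₁ k₂ →
    ∃ λ β → InBlock β k₀ × InBlock β k₁ × InBlock β k₂
  triangle-through-inner-in-block {k₀} {k₁} {k₂} = from-yes (all? λ k₀ → all? λ k₁ → all? λ k₂ →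
    inner? k₀ →-dec linked? k₀ k₁ →-dec linked? k₀ k₂ →-dec linked? k₁ k₂ →-dec
    any? λ β → inBlock? β k₀ ×-dec inBlock? β k₁ ×-dec inBlock? β k₂) k₀ k₁ k₂

  block-has-inner : ∀ {β ka kc kd} → InBlock β ka → InBlock β kc → InBlock β kd →
    ka ≢ kc → ka ≢ kd → kc ≢ kd → Inner ka ⊎ Inner kc ⊎ Inner kd
  block-has-inner {β} {ka} {kc} {kd} = from-yes (all? λ β → all? λ ka → all? λ kc → all? λ kd →
    inBlock? β ka →-dec inBlock? β kc →-dec inBlock? β kd →-dec
    ¬? (ka ≟ kc) →-dec ¬? (ka ≟ kd) →-dec ¬? (kc ≟ kd) →-dec
    (inner? ka ⊎-dec inner? kc ⊎-dec inner? kd)) β ka kc kd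

  linked-to-three-of-block : ∀ {β ka kc kd kp} → InBlock β ka → InBlock β kc → InBlock β kd →
    ka ≢ kc → ka ≢ kd → kc ≢ kd → Linked kp ka → Linked kp kc → Linked kp kd → InBlock β kp
  linked-to-three-of-block {β} {ka} {kc} {kd} {kp} ia ic id ac ad cd =
    from-yes (all? λ β → all? λ ka → all? λ kc → all? λ kd →
      inBlock? β ka →-dec inBlock? β kc →-dec inBlock? β kd →-dec
      ¬? (ka ≟ kc) →-dec ¬? (ka ≟ kd) →-dec ¬? (kc ≟ kd) →-dec all? λ kp →
      linked? kp ka →-dec linked? kp kc →-dec linked? kp kd →-dec inBlock? β kp)
      β ka kc kd ia ic id ac ad cd kp

  inner-linked-to-three-outer : ∀ {kp ka kc kd} → Inner kp → Outer ka → Outer kc → Outer kd →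
    ka ≢ kc → ka ≢ kd → kc ≢ kd → Linked kp ka → Linked kp kc → Linked kp kd → ⊥
  inner-linked-to-three-outer {kp} {ka} {kc} {kd} = from-yes (all? λ kp → all? λ ka → all? λ kc → all? λ kd →
    inner? kp →-dec outer? ka →-dec outer? kc →-dec outer? kd →-dec
    ¬? (ka ≟ kc) →-dec ¬? (ka ≟ kd) →-dec ¬? (kc ≟ kd) →-dec
    linked? kp ka →-dec linked? kp kc →-dec linked? kp kd →-dec no λ ()) kp ka kc kd

block : (Fin 11 → V) → Fin 3 → Vec V 5
block v β = map v (blockIndices β)

block-chainEdge : ∀ v β → ChainEdge v (block v β)
block-chainEdge v 0F = inj₁ refl
block-chainEdge v 1F = inj₂ (inj₁ refl)
block-chainEdge v 2F = inj₂ (inj₂ refl)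

chainEdge-block : ∀ {v e} → ChainEdge v e → ∃ λ β → e ≡ block v β
chainEdge-block (inj₁ refl) = 0F , refl
chainEdge-block (inj₂ (inj₁ refl)) = 1F , refl
chainEdge-block (inj₂ (inj₂ refl)) = 2F , refl

∈-block⁻ : ∀ {v β a} → a ∈ block v β → ∃ λ k → InBlock β k × a ≡ v k
∈-block⁻ a∈ = let k , k∈ , a≡ = find (map⁻ a∈) in k , ∈⇒InBlock k∈ , a≡

∈-block⁺ : ∀ {v β a k} → InBlock β k → a ≡ v k → a ∈ block v β
∈-block⁺ {v} k∈β refl = ∈-map⁺ v (InBlock⇒∈ k∈β)

index-distinct : ∀ {A : Set} {n} {xs : Vec A n} {v v′} (v∈ : v ∈ xs) (v′∈ : v′ ∈ xs) →
  v ≢ v′ → index v∈ ≢ index v′∈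
index-distinct {xs = xs} v∈ v′∈ v≢v′ eq =
  v≢v′ (trans (lookup-index v∈) (trans (cong (lookup xs) eq) (sym (lookup-index v′∈))))

IsNew : V → Set
IsNew v = ∃₂ λ j m → v ≡ u j m

x∈E : ∀ {a i B r} → r ≤ 1 → a ≡ r + i → x a ∈ E i B
x∈E z≤n       refl = here refl
x∈E (s≤s z≤n) refl = there (here refl)

y∈E : ∀ {c i B} → c ≡ i + B → y c ∈ E i B
y∈E refl = there (there (here refl))

z∈E : ∀ {d i B r} → r ≤ 1 → d ≡ r + (i + 2 * B) → z d ∈ E i B
z∈E z≤n       refl = there (there (there (here refl)))
z∈E (s≤s z≤n) refl = there (there (there (there (here refl))))

x∈E⁻¹ : ∀ {a i B} → x a ∈ E i B → ∃ λ r → r ≤ 1 × a ≡ r + i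
x∈E⁻¹ (here refl)                           = 0 , z≤n , refl
x∈E⁻¹ (there (here refl))                   = 1 , s≤s z≤n , refl
x∈E⁻¹ (there (there (here ())))
x∈E⁻¹ (there (there (there (here ()))))
x∈E⁻¹ (there (there (there (there (here ())))))

y∈E⁻¹ : ∀ {c i B} → y c ∈ E i B → c ≡ i + B
y∈E⁻¹ (here ())
y∈E⁻¹ (there (here ()))
y∈E⁻¹ (there (there (here refl)))           = refl
y∈E⁻¹ (there (there (there (here ()))))
y∈E⁻¹ (there (there (there (there (here ())))))

z∈E⁻¹ : ∀ {d i B} → z d ∈ E i B → ∃ λ r → r ≤ 1 × d ≡ r + (i + 2 * B)
z∈E⁻¹ (here ())
z∈E⁻¹ (there (here ()))
z∈E⁻¹ (there (there (here ())))
z∈E⁻¹ (there (there (there (here refl))))   = 0 , z≤n , refl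
z∈E⁻¹ (there (there (there (there (here refl))))) = 1 , s≤s z≤n , refl

E-vertex-old : ∀ {v i B} → v ∈ E i B → ¬ IsNew v
E-vertex-old (here refl)                                 (_ , _ , ())
E-vertex-old (there (here refl))                         (_ , _ , ())
E-vertex-old (there (there (here refl)))                 (_ , _ , ())
E-vertex-old (there (there (there (here refl))))         (_ , _ , ())
E-vertex-old (there (there (there (there (here refl))))) (_ , _ , ())

x-old : ∀ {a} → ¬ IsNew (x a)
x-old (_ , _ , ())
y-old : ∀ {c} → ¬ IsNew (y c)
y-old (_ , _ , ())
z-old : ∀ {d} → ¬ IsNew (z d)
z-old (_ , _ , ())

new-or-old : ∀ v → IsNew v ⊎ ¬ IsNew v
new-or-old (u j m) = inj₁ (j , m , refl)
new-or-old (x _)   = inj₂ x-old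
new-or-old (y _)   = inj₂ y-old
new-or-old (z _)   = inj₂ z-old

InF-old : ∀ {B a v} → InF B a v → ¬ IsNew v
InF-old (inj₁ refl) (_ , _ , ())
InF-old (inj₂ refl) (_ , _ , ())

Consecutive : ℕ → ℕ → Set
Consecutive a a′ = suc a ≡ a′ ⊎ suc a′ ≡ a

units-consecutive : ∀ {r r′ n} → r ≤ 1 → r′ ≤ 1 → r + n ≢ r′ + n → Consecutive (r + n) (r′ + n)
units-consecutive z≤n       z≤n       ne = ⊥-elim (ne refl)
units-consecutive z≤n       (s≤s z≤n) _  = inj₁ refl
units-consecutive (s≤s z≤n) z≤n       _  = inj₂ refl
units-consecutive (s≤s z≤n) (s≤s z≤n) ne = ⊥-elim (ne refl)

consecutive-triangle : ∀ {a a′ a″} → Consecutive a a′ → Consecutive a a″ → Consecutive a′ a″ → a′ ≢ a″ → ⊥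
consecutive-triangle (inj₁ refl) (inj₁ refl) _ a′≢a″ = a′≢a″ refl
consecutive-triangle (inj₂ refl) (inj₂ refl) _ a′≢a″ = a′≢a″ refl
consecutive-triangle (inj₁ refl) (inj₂ refl) (inj₁ ())
consecutive-triangle (inj₁ refl) (inj₂ refl) (inj₂ ())
consecutive-triangle (inj₂ refl) (inj₁ refl) (inj₁ ())
consecutive-triangle (inj₂ refl) (inj₁ refl) (inj₂ ())

module _ {t : ℕ} {b b′ s ℓ : ℕ → ℕ} {w : ℕ → Fin 11 → V}
         (b≡10b′ : ∀ j → j < t → b j ≡ 10 * b′ j) (ap-free : ThreeAPFree t b′)
         (chains : ChainsChosen t b s ℓ w) where

  H : Hypergraph5 V
  H = H'B t b s ℓ w

  Adj : V → V → Set
  Adj = Adj2 H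

  adj-sym : ∀ {p q} → Adj p q → Adj q p
  adj-sym (p≢q , e , e∈H , p∈e , q∈e) = p≢q ∘ sym , e , e∈H , q∈e , p∈e

  SharedEdge : V → V → V → Set
  SharedEdge p q r = ∃ λ e → H e × p ∈ e × q ∈ e × r ∈ e

  b-tens : ∀ {j} → j < t → b j ≡ b′ j * 10
  b-tens {j} j<t = trans (b≡10b′ j j<t) (*-comm 10 (b′ j))

  2b-tens : ∀ {j} → j < t → 2 * b j ≡ 2 * b′ j * 10
  2b-tens {j} j<t = trans (cong (2 *_) (b-tens j<t)) (sym (*-assoc 2 (b′ j) 10))

  b-cong : ∀ {j₁ j₂} → j₁ < t → j₂ < t → b′ j₁ ≡ b′ j₂ → b j₁ ≡ b j₂
  b-cong j₁<t j₂<t eq = trans (b-tens j₁<t) (trans (cong (_* 10) eq) (sym (b-tens j₂<t)))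

  -- Opaque because unfolding these proofs during later unification is very costly.
  opaque
    offset-triangle-b : ∀ {p q r B₁ B₂ j₁ j₂} → j₁ < t → j₂ < t → B₁ + B₂ ≡ b j₁ →
      (o₁ : Offset p q B₁) (o₂ : Offset q r B₂) (o₃ : Offset p r (b j₂)) → Balanced o₁ o₂ o₃ × b j₁ ≡ b j₂
    offset-triangle-b j₁<t j₂<t sum o₁ o₂ o₃ =
      let balanced , b′≡ = offset-triangle-tens (trans sum (b-tens j₁<t)) (b-tens j₂<t) o₁ o₂ o₃
      in balanced , b-cong j₁<t j₂<t b′≡

    offset-triangle-2b : ∀ {p q r B₁ B₂ j₁ j₂} → j₁ < t → j₂ < t → B₁ + B₂ ≡ 2 * b j₁ →
      (o₁ : Offset p q B₁) (o₂ : Offset q r B₂) (o₃ : Offset p r (2 * b j₂)) → Balanced o₁ o₂ o₃ × b j₁ ≡ b j₂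
    offset-triangle-2b j₁<t j₂<t sum o₁ o₂ o₃ =
      let balanced , 2b′≡ = offset-triangle-tens (trans sum (2b-tens j₁<t)) (2b-tens j₂<t) o₁ o₂ o₃
      in balanced , b-cong j₁<t j₂<t (*-cancelˡ-≡ _ _ 2 2b′≡)

    offset-triangle-ap : ∀ {p q r j₁ j₂ j₃} → j₁ < t → j₂ < t → j₃ < t →
      (o₁ : Offset p q (b j₁)) (o₂ : Offset q r (b j₂)) (o₃ : Offset p r (2 * b j₃)) →
      Balanced o₁ o₂ o₃ × b j₁ ≡ b j₃ × b j₂ ≡ b j₃
    offset-triangle-ap {j₁ = j₁} {j₂} {j₃} j₁<t j₂<t j₃<t o₁ o₂ o₃ =
      let balanced , sum≡ = offset-triangle-tens sum-tens (2b-tens j₃<t) o₁ o₂ o₃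
          b′₃≡b′₁ , b′₁≡b′₂ = ap-free j₃ j₁ j₂ j₃<t j₁<t j₂<t (sym sum≡)
      in balanced , b-cong j₁<t j₃<t (sym b′₃≡b′₁) , b-cong j₂<t j₃<t (sym (trans b′₃≡b′₁ b′₁≡b′₂))
      where
      sum-tens : b j₁ + b j₂ ≡ (b′ j₁ + b′ j₂) * 10
      sum-tens = trans (cong₂ _+_ (b-tens j₁<t) (b-tens j₂<t)) (sym (*-distribʳ-+ 10 (b′ j₁) (b′ j₂)))

  Edge : ℕ → ℕ → Set
  Edge j i = j < t × s j ≤ i × suc i ≤ ℓ j

  edge∈H : ∀ {j i} → Edge j i → H (E i (b j))
  edge∈H {j} {i} (j<t , sⱼ≤i , i<ℓⱼ) = inj₁ (j , j<t , i , sⱼ≤i , i<ℓⱼ , refl)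

  -- Chains

  chain-j<t : ∀ {j} → suc j < t → j < t
  chain-j<t {j} lt = <-trans (n<1+n j) lt

  block∈H : ∀ {j} β → suc j < t → H (block (w j) β)
  block∈H β lt = inj₂ (_ , lt , block-chainEdge (w _) β)

  inner-vertex : ∀ {j k} → suc j < t → Inner k → ∃ λ m → w j k ≡ u j m
  inner-vertex {j} {k} lt (2≤k , k≤8) = proj₂ (proj₂ (proj₂ (chains j lt))) k 2≤k k≤8

  head-vertex : ∀ {j k} → suc j < t → Head k → InF (b j) (ℓ j) (w j k)
  head-vertex {j} lt (here refl) with proj₁ (proj₂ (chains j lt))
  ... | inj₁ (w₀≡x , _) = inj₁ w₀≡x
  ... | inj₂ (_ , w₀≡z) = inj₂ w₀≡z
  head-vertex {j} lt (there (here refl)) with proj₁ (proj₂ (chains j lt))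
  ... | inj₁ (_ , w₁≡z) = inj₂ w₁≡z
  ... | inj₂ (w₁≡x , _) = inj₁ w₁≡x

  tail-vertex : ∀ {j k} → suc j < t → Tail k → InF (b (suc j)) (s (suc j)) (w j k)
  tail-vertex {j} lt (here refl) with proj₁ (proj₂ (proj₂ (chains j lt)))
  ... | inj₁ (w₉≡x , _) = inj₁ w₉≡x
  ... | inj₂ (_ , w₉≡z) = inj₂ w₉≡z
  tail-vertex {j} lt (there (here refl)) with proj₁ (proj₂ (proj₂ (chains j lt)))
  ... | inj₁ (_ , w₁₀≡z) = inj₂ w₁₀≡z
  ... | inj₂ (w₁₀≡x , _) = inj₁ w₁₀≡x

  outer-vertex-old : ∀ {j k} → suc j < t → Outer k → ¬ IsNew (w j k)
  outer-vertex-old {j} lt (inj₁ head) = InF-old {b j} (head-vertex lt head)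
  outer-vertex-old {j} lt (inj₂ tail) = InF-old {b (suc j)} (tail-vertex lt tail)

  inner-index-of-new : ∀ {j k v} → suc j < t → v ≡ w j k → IsNew v → Inner k
  inner-index-of-new {k = k} lt v≡ new with inner-or-outer k
  ... | inj₁ inner = inner
  ... | inj₂ outer = ⊥-elim (outer-vertex-old lt outer (subst IsNew v≡ new))

  outer-index-of-old : ∀ {j k v} → suc j < t → v ≡ w j k → ¬ IsNew v → Outer k
  outer-index-of-old {j} {k} lt v≡ old with inner-or-outer k
  ... | inj₁ inner = ⊥-elim (old (subst IsNew (sym v≡) (_ , inner-vertex lt inner)))
  ... | inj₂ outer = outer

  chain-index-injective : ∀ {j k k′ v} → suc j < t → v ≡ w j k → v ≡ w j k′ → k ≡ k′
  chain-index-injective {j} lt v≡ v≡′ = proj₁ (chains j lt) (trans (sym v≡) v≡′)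

  chain-index-distinct : ∀ {j k k′ v v′} → v ≡ w j k → v′ ≡ w j k′ → v ≢ v′ → k ≢ k′
  chain-index-distinct v≡ v′≡ v≢v′ refl = v≢v′ (trans v≡ (sym v′≡))

  edge-through-new-vertex : ∀ {e j m} → H e → u j m ∈ e → suc j < t × ∃ λ β → e ≡ block (w j) β
  edge-through-new-vertex (inj₁ (_ , _ , _ , _ , _ , refl)) u∈E = ⊥-elim (E-vertex-old u∈E (_ , _ , refl))
  edge-through-new-vertex (inj₂ (j′ , lt , chain)) u∈e with chainEdge-block {w j′} chain
  ... | β , refl with ∈-block⁻ u∈e
  ... | k , _ , u≡w with inner-vertex lt (inner-index-of-new lt u≡w (_ , _ , refl))
  ... | _ , w≡u′ with trans u≡w w≡u′
  ... | refl = lt , β , refl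

  record ChainNeighbours (j : ℕ) (p q : V) : Set where
    constructor chain-neighbours
    field
      chain : suc j < t
      {β} : Fin 3
      {kp kq} : Fin 11
      kp∈β : InBlock β kp
      kq∈β : InBlock β kq
      p≡ : p ≡ w j kp
      q≡ : q ≡ w j kq

  new-vertex-neighbours : ∀ {j m q} → Adj (u j m) q → ChainNeighbours j (u j m) q
  new-vertex-neighbours (_ , e , e∈H , u∈e , q∈e) with edge-through-new-vertex e∈H u∈e
  ... | lt , β , refl with ∈-block⁻ u∈e | ∈-block⁻ q∈e
  ... | _ , ku∈β , u≡ | _ , kq∈β , q≡ = chain-neighbours lt ku∈β kq∈β u≡ q≡

  inner-adjacency-same-block : ∀ {j k k′} → suc j < t → Inner k → Adj (w j k) (w j k′) → SameBlock k k′
  inner-adjacency-same-block {j} {k′ = k′} lt inner adj with inner-vertex lt inner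
  ... | m , w≡u with new-vertex-neighbours (subst (λ v → Adj v (w j k′)) w≡u adj)
  ... | chain-neighbours _ kp∈β kq∈β u≡ q≡ =
    _ , subst (InBlock _) (sym (chain-index-injective lt (sym w≡u) u≡)) kp∈β
      , subst (InBlock _) (sym (chain-index-injective {v = w j k′} lt refl q≡)) kq∈β

  chain-adjacency-linked : ∀ {j k k′ p q} → suc j < t → p ≡ w j k → q ≡ w j k′ → Adj p q → Linked k k′
  chain-adjacency-linked {k = k} {k′} lt refl refl adj with inner-or-outer k | inner-or-outer k′
  ... | inj₁ inner | _ = inj₁ (inner-adjacency-same-block lt inner adj)
  ... | _ | inj₁ inner′ =
    let β , k′∈β , k∈β = inner-adjacency-same-block lt inner′ (adj-sym adj) in inj₁ (β , k∈β , k′∈β)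
  ... | inj₂ outer | inj₂ outer′ = inj₂ (outer , outer′)

  triangle-through-new-vertex : ∀ {j m q r} → Adj (u j m) q → Adj (u j m) r → Adj q r → SharedEdge (u j m) q r
  triangle-through-new-vertex uq ur qr with new-vertex-neighbours uq | new-vertex-neighbours ur
  ... | chain-neighbours lt _ _ u≡ q≡ | chain-neighbours _ _ _ _ r≡
    with triangle-through-inner-in-block (inner-index-of-new lt u≡ (_ , _ , refl))
           (chain-adjacency-linked lt u≡ q≡ uq) (chain-adjacency-linked lt u≡ r≡ ur)
           (chain-adjacency-linked lt q≡ r≡ qr)
  ... | β , ku∈β , kq∈β , kr∈β =
    block (w _) β , block∈H β lt , ∈-block⁺ ku∈β u≡ , ∈-block⁺ kq∈β q≡ , ∈-block⁺ kr∈β r≡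

  chain-neighbour-of-inner : ∀ {j k v p} → suc j < t → v ≡ w j k → Inner k → Adj p v → ∃ λ kp → p ≡ w j kp
  chain-neighbour-of-inner {p = p} lt v≡ inner pv with inner-vertex lt inner
  ... | _ , w≡u with new-vertex-neighbours (adj-sym (subst (Adj p) (trans v≡ w≡u) pv))
  ... | chain-neighbours _ _ _ _ p≡ = _ , p≡

  common-neighbour-in-block : ∀ {j β p a c d} → suc j < t →
    a ∈ block (w j) β → c ∈ block (w j) β → d ∈ block (w j) β →
    a ≢ c → a ≢ d → c ≢ d → Adj p a → Adj p c → Adj p d → p ∈ block (w j) β
  common-neighbour-in-block {j} {β} {p} lt a∈ c∈ d∈ a≢c a≢d c≢d pa pc pd
    with ∈-block⁻ a∈ | ∈-block⁻ c∈ | ∈-block⁻ d∈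
  ... | ka , ka∈β , a≡ | kc , kc∈β , c≡ | kd , kd∈β , d≡ =
    let ka≢kc = chain-index-distinct a≡ c≡ a≢c
        ka≢kd = chain-index-distinct a≡ d≡ a≢d
        kc≢kd = chain-index-distinct c≡ d≡ c≢d
        kp , p≡ = p-in-chain (block-has-inner ka∈β kc∈β kd∈β ka≢kc ka≢kd kc≢kd)
    in ∈-block⁺ (linked-to-three-of-block ka∈β kc∈β kd∈β ka≢kc ka≢kd kc≢kd
                   (chain-adjacency-linked lt p≡ a≡ pa) (chain-adjacency-linked lt p≡ c≡ pc)
                   (chain-adjacency-linked lt p≡ d≡ pd))
                p≡
    where
    p-in-chain : Inner ka ⊎ Inner kc ⊎ Inner kd → ∃ λ kp → p ≡ w j kp
    p-in-chain (inj₁ inner)        = chain-neighbour-of-inner lt a≡ inner pa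
    p-in-chain (inj₂ (inj₁ inner)) = chain-neighbour-of-inner lt c≡ inner pc
    p-in-chain (inj₂ (inj₂ inner)) = chain-neighbour-of-inner lt d≡ inner pd

  new-vertex-not-adjacent-to-three-of-edge : ∀ {j m i B a c d} → a ∈ E i B → c ∈ E i B → d ∈ E i B →
    a ≢ c → a ≢ d → c ≢ d → Adj (u j m) a → Adj (u j m) c → Adj (u j m) d → ⊥
  new-vertex-not-adjacent-to-three-of-edge a∈ c∈ d∈ a≢c a≢d c≢d ua uc ud
    with new-vertex-neighbours ua | new-vertex-neighbours uc | new-vertex-neighbours ud
  ... | chain-neighbours lt _ _ u≡ a≡ | chain-neighbours _ _ _ _ c≡ | chain-neighbours _ _ _ _ d≡ =
    inner-linked-to-three-outer (inner-index-of-new lt u≡ (_ , _ , refl))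
      (outer-index-of-old lt a≡ (E-vertex-old a∈)) (outer-index-of-old lt c≡ (E-vertex-old c∈))
      (outer-index-of-old lt d≡ (E-vertex-old d∈))
      (chain-index-distinct a≡ c≡ a≢c) (chain-index-distinct a≡ d≡ a≢d) (chain-index-distinct c≡ d≡ c≢d)
      (chain-adjacency-linked lt u≡ a≡ ua) (chain-adjacency-linked lt u≡ c≡ uc) (chain-adjacency-linked lt u≡ d≡ ud)

  -- Adjacency of old vertices

  data AdjacencyReason (p q : V) : Set where
    common-edge : ∀ {j i} → Edge j i → p ∈ E i (b j) → q ∈ E i (b j) → AdjacencyReason p q
    chain-ends  : ∀ {j a} → j < t → InF (b j) a p → InF (b j) a q → AdjacencyReason p q

  adjacency-reason : ∀ {p q} → ¬ IsNew p → ¬ IsNew q → Adj p q → AdjacencyReason p q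
  adjacency-reason _ _ (_ , _ , inj₁ (_ , j<t , _ , sⱼ≤i , i<ℓⱼ , refl) , p∈ , q∈) = common-edge (j<t , sⱼ≤i , i<ℓⱼ) p∈ q∈
  adjacency-reason old-p old-q (_ , _ , inj₂ (j′ , lt , chain) , p∈ , q∈) with chainEdge-block {w j′} chain
  ... | β , refl with ∈-block⁻ p∈ | ∈-block⁻ q∈
  ... | kp , kp∈β , p≡ | kq , kq∈β , q≡
    with outer-pair-in-block (β , kp∈β , kq∈β) (outer-index-of-old lt p≡ old-p) (outer-index-of-old lt q≡ old-q)
  ... | inj₁ (head-p , head-q) =
    chain-ends (chain-j<t lt) (subst (InF (b j′) (ℓ j′)) (sym p≡) (head-vertex lt head-p))
                              (subst (InF (b j′) (ℓ j′)) (sym q≡) (head-vertex lt head-q))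
  ... | inj₂ (tail-p , tail-q) =
    chain-ends lt (subst (InF (b (suc j′)) (s (suc j′))) (sym p≡) (tail-vertex lt tail-p))
                  (subst (InF (b (suc j′)) (s (suc j′))) (sym q≡) (tail-vertex lt tail-q))

  record XYLink (a c : ℕ) : Set where
    constructor xy-link
    field
      {j i r} : ℕ
      edge : Edge j i
      r≤1  : r ≤ 1
      x-at : a ≡ r + i
      y-at : c ≡ i + b j

    j<t : j < t
    j<t = proj₁ edge

  record YZLink (c d : ℕ) : Set where
    constructor yz-link
    field
      {j i r} : ℕ
      edge : Edge j i
      r≤1  : r ≤ 1
      y-at : c ≡ i + b j
      z-at : d ≡ r + (i + 2 * b j)

    j<t : j < t
    j<t = proj₁ edge

  -- A pair x_a, z_{a+2b_j} at the end of a chain is recorded with i = a and r₁ = r₂ = 0.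
  record XZLink (a d : ℕ) : Set where
    constructor xz-link
    field
      {j i r₁ r₂} : ℕ
      j<t   : j < t
      r₁≤1  : r₁ ≤ 1
      r₂≤1  : r₂ ≤ 1
      x-at  : a ≡ r₁ + i
      z-at  : d ≡ r₂ + (i + 2 * b j)
      edge-or-chain : Edge j i ⊎ r₁ ≡ r₂

  xy-link-of : ∀ {a c} → Adj (x a) (y c) → XYLink a c
  xy-link-of adj with adjacency-reason x-old y-old adj
  ... | common-edge edge x∈ y∈ = let _ , r≤1 , x-at = x∈E⁻¹ x∈ in xy-link edge r≤1 x-at (y∈E⁻¹ y∈)
  ... | chain-ends _ _ (inj₁ ())
  ... | chain-ends _ _ (inj₂ ())

  yz-link-of : ∀ {c d} → Adj (y c) (z d) → YZLink c d
  yz-link-of adj with adjacency-reason y-old z-old adj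
  ... | common-edge edge y∈ z∈ = let _ , r≤1 , z-at = z∈E⁻¹ z∈ in yz-link edge r≤1 (y∈E⁻¹ y∈) z-at
  ... | chain-ends _ (inj₁ ()) _
  ... | chain-ends _ (inj₂ ()) _

  xz-link-of : ∀ {a d} → Adj (x a) (z d) → XZLink a d
  xz-link-of adj with adjacency-reason x-old z-old adj
  ... | common-edge edge x∈ z∈ =
    let _ , r₁≤1 , x-at = x∈E⁻¹ x∈ ; _ , r₂≤1 , z-at = z∈E⁻¹ z∈ in
    xz-link (proj₁ edge) r₁≤1 r₂≤1 x-at z-at (inj₁ edge)
  ... | chain-ends j<t (inj₁ refl) (inj₂ refl) = xz-link j<t z≤n z≤n refl refl (inj₂ refl)
  ... | chain-ends _ (inj₂ ()) _
  ... | chain-ends _ _ (inj₁ ())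

  xx-consecutive : ∀ {a a′} → Adj (x a) (x a′) → Consecutive a a′
  xx-consecutive adj@(x≢x′ , _) with adjacency-reason x-old x-old adj
  ... | common-edge _ x∈ x′∈ with x∈E⁻¹ x∈ | x∈E⁻¹ x′∈
  ... | _ , r≤1 , refl | _ , r′≤1 , refl = units-consecutive r≤1 r′≤1 (x≢x′ ∘ cong x)
  xx-consecutive (x≢x′ , _) | chain-ends _ (inj₁ refl) (inj₁ refl) = ⊥-elim (x≢x′ refl)
  xx-consecutive _ | chain-ends _ _ (inj₂ ())
  xx-consecutive _ | chain-ends _ (inj₂ ()) _

  zz-consecutive : ∀ {d d′} → Adj (z d) (z d′) → Consecutive d d′
  zz-consecutive adj@(z≢z′ , _) with adjacency-reason z-old z-old adj
  ... | common-edge _ z∈ z′∈ with z∈E⁻¹ z∈ | z∈E⁻¹ z′∈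
  ... | _ , r≤1 , refl | _ , r′≤1 , refl = units-consecutive r≤1 r′≤1 (z≢z′ ∘ cong z)
  zz-consecutive (z≢z′ , _) | chain-ends _ (inj₂ refl) (inj₂ refl) = ⊥-elim (z≢z′ refl)
  zz-consecutive _ | chain-ends _ _ (inj₁ ())
  zz-consecutive _ | chain-ends _ (inj₁ ()) _

  yy-nonadjacent : ∀ {c c′} → ¬ Adj (y c) (y c′)
  yy-nonadjacent adj@(y≢y′ , _) with adjacency-reason y-old y-old adj
  ... | common-edge _ y∈ y′∈ = y≢y′ (cong y (trans (y∈E⁻¹ y∈) (sym (y∈E⁻¹ y′∈))))
  ... | chain-ends _ (inj₁ ()) _
  ... | chain-ends _ (inj₂ ()) _

  xy-offset : ∀ {a c} (h : XYLink a c) → Offset a c (b (XYLink.j h))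
  xy-offset (xy-link {j} {i} {r} _ r≤1 x-at y-at) = offset r 0 r≤1 z≤n (shift-of x-at y-at)
    where
    shift-of : ∀ {a c} → a ≡ r + i → c ≡ i + b j → r + c ≡ a + b j
    shift-of refl refl = sym (+-assoc r i (b j))

  yz-offset : ∀ {c d} (h : YZLink c d) → Offset c d (b (YZLink.j h))
  yz-offset (yz-link {j} {i} {r} _ r≤1 y-at z-at) = offset 0 r z≤n r≤1 (shift-of y-at z-at)
    where
    shift-of : ∀ {c d} → c ≡ i + b j → d ≡ r + (i + 2 * b j) → d ≡ r + (c + b j)
    shift-of refl refl = cong (r +_) (m+2n≡m+n+n i (b j))

  xz-offset : ∀ {a d} (h : XZLink a d) → Offset a d (2 * b (XZLink.j h))
  xz-offset (xz-link {j} {i} {r₁} {r₂} _ r₁≤1 r₂≤1 x-at z-at _) = offset r₁ r₂ r₁≤1 r₂≤1 (shift-of x-at z-at)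
    where
    interchange : ∀ r₁ r₂ i B → r₁ + (r₂ + (i + B)) ≡ r₂ + (r₁ + i + B)
    interchange = solve-∀
    shift-of : ∀ {a d} → a ≡ r₁ + i → d ≡ r₂ + (i + 2 * b j) → r₁ + d ≡ r₂ + (a + 2 * b j)
    shift-of refl refl = interchange r₁ r₂ i (2 * b j)

  edge-of : ∀ {j i r₁ r₂ : ℕ} → Edge j i ⊎ r₁ ≡ r₂ → r₁ ≢ r₂ → Edge j i
  edge-of (inj₁ edge) _ = edge
  edge-of (inj₂ r₁≡r₂) r₁≢r₂ = ⊥-elim (r₁≢r₂ r₁≡r₂)

  -- Triangles

  triangle-xxy : ∀ {a c} → XYLink a c → XYLink (suc a) c → SharedEdge (x a) (x (suc a)) (y c)
  triangle-xxy h₁@(xy-link {j₁} {i} {r₁} edge₁ r₁≤1 refl refl) h₂@(xy-link {r = r₂} edge₂ r₂≤1 _ _) =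
    E i (b j₁) , edge∈H edge₁ , x∈E r₁≤1 refl , x∈E (s≤s z≤n) (cong (λ r → suc (r + i)) r₁≡0) , y∈E refl
    where
    balance : suc r₁ ≡ r₂ + 0
    balance = proj₁ (offset-triangle-b (proj₁ edge₂) (proj₁ edge₁) refl (successor-offset refl) (xy-offset h₂) (xy-offset h₁))
    forces-0 : ∀ {r r′} → r′ ≤ 1 → suc r ≡ r′ + 0 → r ≡ 0
    forces-0 z≤n ()
    forces-0 (s≤s z≤n) refl = refl
    r₁≡0 : r₁ ≡ 0
    r₁≡0 = forces-0 r₂≤1 balance

  triangle-xxz : ∀ {a d} → XZLink a d → XZLink (suc a) d → SharedEdge (x a) (x (suc a)) (z d)
  triangle-xxz h₁@(xz-link {j₁} {i₁} {r₁} {r₂} j₁<t r₁≤1 r₂≤1 refl refl edge₁)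
               h₂@(xz-link {j₂} {i₂} {r₃} {r₄} j₂<t r₃≤1 r₄≤1 x-at₂ z-at₂ edge₂)
    with units-suc-split r₄≤1 r₁≤1 r₃≤1 r₂≤1
           (proj₁ (offset-triangle-2b j₂<t j₁<t refl (successor-offset refl) (xz-offset h₂) (xz-offset h₁)))
  ... | inj₁ (refl , refl) =
    E i₁ (b j₁) , edge∈H (edge-of edge₁ λ ()) , x∈E z≤n refl , x∈E (s≤s z≤n) refl , z∈E (s≤s z≤n) refl
  ... | inj₂ (refl , refl) =
    E i₂ (b j₂) , edge∈H (edge-of edge₂ λ ()) , x∈E z≤n (suc-injective x-at₂) , x∈E r₃≤1 x-at₂ , z∈E r₄≤1 z-at₂

  triangle-xyz : ∀ {a c d} → XYLink a c → YZLink c d → XZLink a d → SharedEdge (x a) (y c) (z d)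
  triangle-xyz h₁@(xy-link {j₁} {i₁} edge₁ r₁≤1 refl refl) h₂@(yz-link {j₂} {i₂} {r₂} edge₂ r₂≤1 y-at₂ refl) h₃
    with offset-triangle-ap (proj₁ edge₁) (proj₁ edge₂) (XZLink.j<t h₃) (xy-offset h₁) (yz-offset h₂) (xz-offset h₃)
  ... | _ , b₁≡b₃ , b₂≡b₃ =
    E i₁ (b j₁) , edge∈H edge₁ , x∈E r₁≤1 refl , y∈E refl , z∈E r₂≤1 (cong₂ (λ i B → r₂ + (i + 2 * B)) i₂≡i₁ b₂≡b₁)
    where
    b₂≡b₁ : b j₂ ≡ b j₁
    b₂≡b₁ = trans b₂≡b₃ (sym b₁≡b₃)
    i₂≡i₁ : i₂ ≡ i₁
    i₂≡i₁ = sym (same-start y-at₂ b₂≡b₁)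

  triangle-xzz : ∀ {a d} → XZLink a d → XZLink a (suc d) → SharedEdge (x a) (z d) (z (suc d))
  triangle-xzz h₁@(xz-link {j₁} {i₁} {r₁} {r₂} j₁<t r₁≤1 r₂≤1 refl refl edge₁)
               h₂@(xz-link {j₂} {i₂} {r₃} {r₄} j₂<t r₃≤1 r₄≤1 x-at₂ z-at₂ edge₂)
    with units-suc-split r₂≤1 r₃≤1 r₁≤1 r₄≤1 (m+1+n≡o+0+p⇒suc[m+n]≡o+p {r₂} {r₃} {r₁} {r₄}
           (proj₁ (offset-triangle-2b j₁<t j₂<t (+-identityʳ _) (xz-offset h₁) (successor-offset refl) (xz-offset h₂))))
  ... | inj₁ (refl , refl) =
    E i₂ (b j₂) , edge∈H (edge-of edge₂ λ ()) , x∈E z≤n x-at₂ , z∈E z≤n (suc-injective z-at₂) , z∈E (s≤s z≤n) z-at₂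
  ... | inj₂ (refl , refl) =
    E i₁ (b j₁) , edge∈H (edge-of edge₁ λ ()) , x∈E (s≤s z≤n) refl , z∈E z≤n refl , z∈E (s≤s z≤n) refl

  triangle-yzz : ∀ {c d} → YZLink c d → YZLink c (suc d) → SharedEdge (y c) (z d) (z (suc d))
  triangle-yzz h₁@(yz-link {j₁} {i₁} {r₁} edge₁ r₁≤1 refl refl) h₂@(yz-link {r = r₂} edge₂ r₂≤1 _ _) =
    E i₁ (b j₁) , edge∈H edge₁ , y∈E refl , z∈E r₁≤1 refl , z∈E (s≤s z≤n) (cong (λ r → suc (r + (i₁ + 2 * b j₁))) r₁≡0)
    where
    balance : r₁ + 1 + 0 ≡ r₂
    balance = proj₁ (offset-triangle-b (proj₁ edge₁) (proj₁ edge₂) (+-identityʳ _) (yz-offset h₁) (successor-offset refl) (yz-offset h₂))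
    forces-0 : ∀ {r r′} → r ≤ 1 → r′ ≤ 1 → r + 1 + 0 ≡ r′ → r ≡ 0
    forces-0 z≤n _ _ = refl
    forces-0 (s≤s z≤n) r′≤1 eq = ⊥-elim (2+≢unit r′≤1 eq)
    r₁≡0 : r₁ ≡ 0
    r₁≡0 = forces-0 r₁≤1 r₂≤1 balance

  swap₁₂ : ∀ {p q r} → SharedEdge p q r → SharedEdge q p r
  swap₁₂ (e , e∈H , p∈ , q∈ , r∈) = e , e∈H , q∈ , p∈ , r∈

  swap₂₃ : ∀ {p q r} → SharedEdge p q r → SharedEdge p r q
  swap₂₃ (e , e∈H , p∈ , q∈ , r∈) = e , e∈H , p∈ , r∈ , q∈

  rotate : ∀ {p q r} → SharedEdge p q r → SharedEdge q r p
  rotate (e , e∈H , p∈ , q∈ , r∈) = e , e∈H , q∈ , r∈ , p∈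

  shared-edge-xxy : ∀ {a a′ c} → Adj (x a) (x a′) → Adj (x a) (y c) → Adj (x a′) (y c) → SharedEdge (x a) (x a′) (y c)
  shared-edge-xxy xx xy x′y with xx-consecutive xx
  ... | inj₁ refl = triangle-xxy (xy-link-of xy) (xy-link-of x′y)
  ... | inj₂ refl = swap₁₂ (triangle-xxy (xy-link-of x′y) (xy-link-of xy))

  shared-edge-xxz : ∀ {a a′ d} → Adj (x a) (x a′) → Adj (x a) (z d) → Adj (x a′) (z d) → SharedEdge (x a) (x a′) (z d)
  shared-edge-xxz xx xz x′z with xx-consecutive xx
  ... | inj₁ refl = triangle-xxz (xz-link-of xz) (xz-link-of x′z)
  ... | inj₂ refl = swap₁₂ (triangle-xxz (xz-link-of x′z) (xz-link-of xz))

  shared-edge-xyz : ∀ {a c d} → Adj (x a) (y c) → Adj (x a) (z d) → Adj (y c) (z d) → SharedEdge (x a) (y c) (z d)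
  shared-edge-xyz xy xz yz = triangle-xyz (xy-link-of xy) (yz-link-of yz) (xz-link-of xz)

  shared-edge-xzz : ∀ {a d d′} → Adj (x a) (z d) → Adj (x a) (z d′) → Adj (z d) (z d′) → SharedEdge (x a) (z d) (z d′)
  shared-edge-xzz xz xz′ zz with zz-consecutive zz
  ... | inj₁ refl = triangle-xzz (xz-link-of xz) (xz-link-of xz′)
  ... | inj₂ refl = swap₂₃ (triangle-xzz (xz-link-of xz′) (xz-link-of xz))

  shared-edge-yzz : ∀ {c d d′} → Adj (y c) (z d) → Adj (y c) (z d′) → Adj (z d) (z d′) → SharedEdge (y c) (z d) (z d′)
  shared-edge-yzz yz yz′ zz with zz-consecutive zz
  ... | inj₁ refl = triangle-yzz (yz-link-of yz) (yz-link-of yz′)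
  ... | inj₂ refl = swap₂₃ (triangle-yzz (yz-link-of yz′) (yz-link-of yz))

  triangle-in-edge : ∀ {p q r} → Adj p q → Adj p r → Adj q r → SharedEdge p q r
  triangle-in-edge {u _ _}         pq pr qr = triangle-through-new-vertex pq pr qr
  triangle-in-edge {_} {u _ _}     pq pr qr = swap₁₂ (triangle-through-new-vertex (adj-sym pq) qr pr)
  triangle-in-edge {_} {_} {u _ _} pq pr qr = rotate (triangle-through-new-vertex (adj-sym pr) (adj-sym qr) pq)
  triangle-in-edge {x _} {x _} {x _} pq pr qr =
    ⊥-elim (consecutive-triangle (xx-consecutive pq) (xx-consecutive pr) (xx-consecutive qr) (proj₁ qr ∘ cong x))
  triangle-in-edge {x _} {x _} {y _} pq pr qr = shared-edge-xxy pq pr qr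
  triangle-in-edge {x _} {x _} {z _} pq pr qr = shared-edge-xxz pq pr qr
  triangle-in-edge {x _} {y _} {x _} pq pr qr = swap₂₃ (shared-edge-xxy pr pq (adj-sym qr))
  triangle-in-edge {x _} {y _} {y _} pq pr qr = ⊥-elim (yy-nonadjacent qr)
  triangle-in-edge {x _} {y _} {z _} pq pr qr = shared-edge-xyz pq pr qr
  triangle-in-edge {x _} {z _} {x _} pq pr qr = swap₂₃ (shared-edge-xxz pr pq (adj-sym qr))
  triangle-in-edge {x _} {z _} {y _} pq pr qr = swap₂₃ (shared-edge-xyz pr pq (adj-sym qr))
  triangle-in-edge {x _} {z _} {z _} pq pr qr = shared-edge-xzz pq pr qr
  triangle-in-edge {y _} {x _} {x _} pq pr qr = swap₁₂ (swap₂₃ (shared-edge-xxy qr (adj-sym pq) (adj-sym pr)))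
  triangle-in-edge {y _} {x _} {y _} pq pr qr = ⊥-elim (yy-nonadjacent pr)
  triangle-in-edge {y _} {x _} {z _} pq pr qr = swap₁₂ (shared-edge-xyz (adj-sym pq) qr pr)
  triangle-in-edge {y _} {y _} {_}   pq pr qr = ⊥-elim (yy-nonadjacent pq)
  triangle-in-edge {y _} {z _} {x _} pq pr qr = rotate (shared-edge-xyz (adj-sym pr) (adj-sym qr) pq)
  triangle-in-edge {y _} {z _} {y _} pq pr qr = ⊥-elim (yy-nonadjacent pr)
  triangle-in-edge {y _} {z _} {z _} pq pr qr = shared-edge-yzz pq pr qr
  triangle-in-edge {z _} {x _} {x _} pq pr qr = swap₁₂ (swap₂₃ (shared-edge-xxz qr (adj-sym pq) (adj-sym pr)))
  triangle-in-edge {z _} {x _} {y _} pq pr qr = swap₁₂ (swap₂₃ (shared-edge-xyz qr (adj-sym pq) (adj-sym pr)))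
  triangle-in-edge {z _} {x _} {z _} pq pr qr = swap₁₂ (shared-edge-xzz (adj-sym pq) qr pr)
  triangle-in-edge {z _} {y _} {x _} pq pr qr =
    swap₁₂ (swap₂₃ (swap₁₂ (shared-edge-xyz (adj-sym qr) (adj-sym pr) (adj-sym pq))))
  triangle-in-edge {z _} {y _} {y _} pq pr qr = ⊥-elim (yy-nonadjacent qr)
  triangle-in-edge {z _} {y _} {z _} pq pr qr = swap₁₂ (shared-edge-yzz (adj-sym pq) qr pr)
  triangle-in-edge {z _} {z _} {x _} pq pr qr = rotate (shared-edge-xzz (adj-sym pr) (adj-sym qr) pq)
  triangle-in-edge {z _} {z _} {y _} pq pr qr = rotate (shared-edge-yzz (adj-sym pr) (adj-sym qr) pq)
  triangle-in-edge {z _} {z _} {z _} pq pr qr =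
    ⊥-elim (consecutive-triangle (zz-consecutive pq) (zz-consecutive pr) (zz-consecutive qr) (proj₁ qr ∘ cong z))

  -- Common neighbours

  x∈E-via-x₀y : ∀ {j i α} → Edge j i → Adj (x α) (x i) → Adj (x α) (y (i + b j)) → x α ∈ E i (b j)
  x∈E-via-x₀y {j} edge xx xy with xx-consecutive xx
  ... | inj₂ refl = x∈E (s≤s z≤n) refl
  ... | inj₁ refl with xy-link-of xy
  ... | h with proj₁ (offset-triangle-b (proj₁ edge) (XYLink.j<t h) refl
                        (successor-offset refl) (x₀y-offset (b j)) (xy-offset h))
  ... | ()

  x∈E-via-x₀z₁ : ∀ {j i α} → Edge j i → Adj (x α) (x i) → Adj (x α) (z (suc (i + 2 * b j))) → x α ∈ E i (b j)
  x∈E-via-x₀z₁ {j} edge xx xz with xx-consecutive xx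
  ... | inj₂ refl = x∈E (s≤s z≤n) refl
  ... | inj₁ refl with xz-link-of xz
  ... | h = ⊥-elim (2+≢unit (XZLink.r₂≤1 h) (proj₁ (offset-triangle-2b (proj₁ edge) (XZLink.j<t h) refl
                                                     (successor-offset refl) (x₀z₁-offset (b j)) (xz-offset h))))

  x∈E-via-x₁y : ∀ {j i α} → Edge j i → Adj (x α) (x (suc i)) → Adj (x α) (y (i + b j)) → x α ∈ E i (b j)
  x∈E-via-x₁y {j} edge xx xy with xx-consecutive xx
  ... | inj₁ refl = x∈E z≤n refl
  ... | inj₂ refl with xy-link-of xy
  ... | h = ⊥-elim (2+≢unit (XYLink.r≤1 h) (trans balance (+-identityʳ _)))
    where
    balance : 2 ≡ XYLink.r h + 0
    balance = proj₁ (offset-triangle-b (XYLink.j<t h) (proj₁ edge) refl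
                       (successor-offset refl) (xy-offset h) (x₁y-offset (b j)))

  x∈E-via-x₁z₀ : ∀ {j i α} → Edge j i → Adj (x α) (x (suc i)) → Adj (x α) (z (i + 2 * b j)) → x α ∈ E i (b j)
  x∈E-via-x₁z₀ {j} edge xx xz with xx-consecutive xx
  ... | inj₁ refl = x∈E z≤n refl
  ... | inj₂ refl with xz-link-of xz
  ... | h = ⊥-elim (absurd (XZLink.r₁≤1 h) (XZLink.r₂≤1 h) (proj₁ (offset-triangle-2b (XZLink.j<t h) (proj₁ edge) refl
                                                               (successor-offset refl) (xz-offset h) (x₁z₀-offset (b j)))))
    where
    absurd : ∀ {r₁ r₂} → r₁ ≤ 1 → r₂ ≤ 1 → 1 + r₂ + 1 ≢ 0 + r₁ + 0
    absurd z≤n       z≤n       ()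
    absurd z≤n       (s≤s z≤n) ()
    absurd (s≤s z≤n) z≤n       ()
    absurd (s≤s z≤n) (s≤s z≤n) ()

  x∈E-via-y-z : ∀ {j i α ζ} → Edge j i → Offset (i + b j) ζ (b j) →
    Adj (x α) (y (i + b j)) → Adj (x α) (z ζ) → x α ∈ E i (b j)
  x∈E-via-y-z edge yζ xy xz with xy-link-of xy | xz-link-of xz
  ... | h₁@(xy-link edge₁ r≤1 x-at y-at) | h₂
    with offset-triangle-ap (proj₁ edge₁) (proj₁ edge) (XZLink.j<t h₂) (xy-offset h₁) yζ (xz-offset h₂)
  ... | _ , b₁≡b₂ , b≡b₂ = x∈E r≤1 (trans x-at (cong (_ +_) (sym (same-start y-at (trans b₁≡b₂ (sym b≡b₂))))))

  y∈E-via-x₀z₁ : ∀ {j i γ} → Edge j i → Adj (y γ) (x i) → Adj (y γ) (z (suc (i + 2 * b j))) → y γ ∈ E i (b j)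
  y∈E-via-x₀z₁ {j} edge yx yz with xy-link-of (adj-sym yx) | yz-link-of yz
  ... | h₁@(xy-link {i = i₁} {r₁} edge₁ r₁≤1 x-at y-at) | h₂@(yz-link {r = r₂} edge₂ r₂≤1 _ _)
    with offset-triangle-ap (proj₁ edge₁) (proj₁ edge₂) (proj₁ edge) (xy-offset h₁) (yz-offset h₂) (x₀z₁-offset (b j))
  ... | balance , b₁≡b , _ =
    y∈E (trans y-at (cong₂ _+_ (sym (trans x-at (cong (_+ i₁) (r₁≡0 r₁≤1 r₂≤1 balance)))) b₁≡b))
    where
    r₁≡0 : ∀ {r₁ r₂} → r₁ ≤ 1 → r₂ ≤ 1 → 0 + r₂ + 0 ≡ r₁ + 0 + 1 → r₁ ≡ 0
    r₁≡0 z≤n       _         _  = refl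
    r₁≡0 (s≤s z≤n) z≤n       ()
    r₁≡0 (s≤s z≤n) (s≤s z≤n) ()

  y∈E-via-x₁z₀ : ∀ {j i γ} → Edge j i → Adj (y γ) (x (suc i)) → Adj (y γ) (z (i + 2 * b j)) → y γ ∈ E i (b j)
  y∈E-via-x₁z₀ {j} edge yx yz with xy-link-of (adj-sym yx) | yz-link-of yz
  ... | h₁@(xy-link {i = i₁} {r₁} edge₁ r₁≤1 x-at y-at) | h₂@(yz-link {r = r₂} edge₂ r₂≤1 _ _)
    with offset-triangle-ap (proj₁ edge₁) (proj₁ edge₂) (proj₁ edge) (xy-offset h₁) (yz-offset h₂) (x₁z₀-offset (b j))
  ... | balance , b₁≡b , _ =
    y∈E (trans y-at (cong₂ _+_ (suc-injective (sym (trans x-at (cong (_+ i₁) (r₁≡1 r₁≤1 r₂≤1 balance))))) b₁≡b))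
    where
    r₁≡1 : ∀ {r₁ r₂} → r₁ ≤ 1 → r₂ ≤ 1 → 0 + r₂ + 1 ≡ r₁ + 0 + 0 → r₁ ≡ 1
    r₁≡1 (s≤s z≤n) _         _  = refl
    r₁≡1 z≤n       z≤n       ()
    r₁≡1 z≤n       (s≤s z≤n) ()

  z∈E-via-x-y : ∀ {j i δ ξ} → Edge j i → Offset ξ (i + b j) (b j) →
    Adj (z δ) (x ξ) → Adj (z δ) (y (i + b j)) → z δ ∈ E i (b j)
  z∈E-via-x-y {j} {i} edge ξy zx zy with xz-link-of (adj-sym zx) | yz-link-of (adj-sym zy)
  ... | h₁ | h₂@(yz-link {j₂} {i₂} {r} edge₂ r≤1 y-at z-at)
    with offset-triangle-ap (proj₁ edge) (proj₁ edge₂) (XZLink.j<t h₁) ξy (yz-offset h₂) (xz-offset h₁)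
  ... | _ , b≡b₁ , b₂≡b₁ = z∈E r≤1 (trans z-at (cong₂ (λ i B → r + (i + 2 * B)) i₂≡i b₂≡b))
    where
    b₂≡b : b j₂ ≡ b j
    b₂≡b = trans b₂≡b₁ (sym b≡b₁)
    i₂≡i : i₂ ≡ i
    i₂≡i = sym (same-start y-at b₂≡b)

  z∈E-via-x₀z₁ : ∀ {j i δ} → Edge j i → Adj (z δ) (x i) → Adj (z δ) (z (suc (i + 2 * b j))) → z δ ∈ E i (b j)
  z∈E-via-x₀z₁ {j} edge zx zz with zz-consecutive zz
  ... | inj₁ refl = z∈E z≤n refl
  ... | inj₂ refl with xz-link-of (adj-sym zx)
  ... | h = ⊥-elim (2+≢unit (XZLink.r₂≤1 h) (proj₁ (offset-triangle-2b (proj₁ edge) (XZLink.j<t h) (+-identityʳ _)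
                                                     (x₀z₁-offset (b j)) (successor-offset refl) (xz-offset h))))

  z∈E-via-x₁z₀ : ∀ {j i δ} → Edge j i → Adj (z δ) (x (suc i)) → Adj (z δ) (z (i + 2 * b j)) → z δ ∈ E i (b j)
  z∈E-via-x₁z₀ {j} edge zx zz with zz-consecutive zz
  ... | inj₂ refl = z∈E (s≤s z≤n) refl
  ... | inj₁ δ+1≡ with xz-link-of (adj-sym zx)
  ... | h = ⊥-elim (absurd (XZLink.r₁≤1 h) (XZLink.r₂≤1 h) (proj₁ (offset-triangle-2b (XZLink.j<t h) (proj₁ edge) (+-identityʳ _)
                                                               (xz-offset h) (successor-offset δ+1≡) (x₁z₀-offset (b j)))))
    where
    absurd : ∀ {r₁ r₂} → r₁ ≤ 1 → r₂ ≤ 1 → r₂ + 1 + 1 ≢ r₁ + 0 + 0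
    absurd z≤n       z≤n       ()
    absurd z≤n       (s≤s z≤n) ()
    absurd (s≤s z≤n) z≤n       ()
    absurd (s≤s z≤n) (s≤s z≤n) ()

  z∈E-via-yz₀ : ∀ {j i δ} → Edge j i → Adj (z δ) (y (i + b j)) → Adj (z δ) (z (i + 2 * b j)) → z δ ∈ E i (b j)
  z∈E-via-yz₀ {j} edge zy zz with zz-consecutive zz
  ... | inj₂ refl = z∈E (s≤s z≤n) refl
  ... | inj₁ δ+1≡ with yz-link-of (adj-sym zy)
  ... | h = ⊥-elim (absurd (YZLink.r≤1 h) (proj₁ (offset-triangle-b (YZLink.j<t h) (proj₁ edge) (+-identityʳ _)
                                                  (yz-offset h) (successor-offset δ+1≡) (yz₀-offset (b j)))))
    where
    absurd : ∀ {r} → r ≤ 1 → r + 1 + 0 ≢ 0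
    absurd z≤n       ()
    absurd (s≤s z≤n) ()

  z∈E-via-yz₁ : ∀ {j i δ} → Edge j i → Adj (z δ) (y (i + b j)) → Adj (z δ) (z (suc (i + 2 * b j))) → z δ ∈ E i (b j)
  z∈E-via-yz₁ {j} edge zy zz with zz-consecutive zz
  ... | inj₁ refl = z∈E z≤n refl
  ... | inj₂ refl with yz-link-of (adj-sym zy)
  ... | h = ⊥-elim (2+≢unit (YZLink.r≤1 h) (proj₁ (offset-triangle-b (proj₁ edge) (YZLink.j<t h) (+-identityʳ _)
                                                    (yz₁-offset (b j)) (successor-offset refl) (yz-offset h))))

  neighbour-of-rigid-pair-in-edge : ∀ {j i k k′ p} → Edge j i → (k , k′) ∈ rigidPairs → ¬ IsNew p →
    Adj p (lookup (E i (b j)) k) → Adj p (lookup (E i (b j)) k′) → p ∈ E i (b j)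
  neighbour-of-rigid-pair-in-edge {p = u _ _} _    _         old = ⊥-elim (old (_ , _ , refl))
  neighbour-of-rigid-pair-in-edge {p = x _}   edge x₀y-pair  _   = x∈E-via-x₀y edge
  neighbour-of-rigid-pair-in-edge {p = y _}   _    x₀y-pair  _   = λ _ yy → ⊥-elim (yy-nonadjacent yy)
  neighbour-of-rigid-pair-in-edge {p = z _}   edge x₀y-pair  _   = z∈E-via-x-y edge (x₀y-offset _)
  neighbour-of-rigid-pair-in-edge {p = x _}   edge x₀z₁-pair _   = x∈E-via-x₀z₁ edge
  neighbour-of-rigid-pair-in-edge {p = y _}   edge x₀z₁-pair _   = y∈E-via-x₀z₁ edge
  neighbour-of-rigid-pair-in-edge {p = z _}   edge x₀z₁-pair _   = z∈E-via-x₀z₁ edge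
  neighbour-of-rigid-pair-in-edge {p = x _}   edge x₁y-pair  _   = x∈E-via-x₁y edge
  neighbour-of-rigid-pair-in-edge {p = y _}   _    x₁y-pair  _   = λ _ yy → ⊥-elim (yy-nonadjacent yy)
  neighbour-of-rigid-pair-in-edge {p = z _}   edge x₁y-pair  _   = z∈E-via-x-y edge (x₁y-offset _)
  neighbour-of-rigid-pair-in-edge {p = x _}   edge x₁z₀-pair _   = x∈E-via-x₁z₀ edge
  neighbour-of-rigid-pair-in-edge {p = y _}   edge x₁z₀-pair _   = y∈E-via-x₁z₀ edge
  neighbour-of-rigid-pair-in-edge {p = z _}   edge x₁z₀-pair _   = z∈E-via-x₁z₀ edge
  neighbour-of-rigid-pair-in-edge {p = x _}   edge yz₀-pair  _   = x∈E-via-y-z edge (yz₀-offset _)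
  neighbour-of-rigid-pair-in-edge {p = y _}   _    yz₀-pair  _   = λ yy _ → ⊥-elim (yy-nonadjacent yy)
  neighbour-of-rigid-pair-in-edge {p = z _}   edge yz₀-pair  _   = z∈E-via-yz₀ edge
  neighbour-of-rigid-pair-in-edge {p = x _}   edge yz₁-pair  _   = x∈E-via-y-z edge (yz₁-offset _)
  neighbour-of-rigid-pair-in-edge {p = y _}   _    yz₁-pair  _   = λ yy _ → ⊥-elim (yy-nonadjacent yy)
  neighbour-of-rigid-pair-in-edge {p = z _}   edge yz₁-pair  _   = z∈E-via-yz₁ edge

  neighbour-of-rigid-positions-in-edge : ∀ {j i p v v′} → Edge j i → ¬ IsNew p →
    (v∈ : v ∈ E i (b j)) (v′∈ : v′ ∈ E i (b j)) → Rigid (index v∈) (index v′∈) → Adj p v → Adj p v′ → p ∈ E i (b j)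
  neighbour-of-rigid-positions-in-edge {p = p} edge old v∈ v′∈ (inj₁ kk′) pv pv′ =
    neighbour-of-rigid-pair-in-edge edge kk′ old (subst (Adj p) (lookup-index v∈) pv) (subst (Adj p) (lookup-index v′∈) pv′)
  neighbour-of-rigid-positions-in-edge {p = p} edge old v∈ v′∈ (inj₂ k′k) pv pv′ =
    neighbour-of-rigid-pair-in-edge edge k′k old (subst (Adj p) (lookup-index v′∈) pv′) (subst (Adj p) (lookup-index v∈) pv)

  common-neighbour-in-E : ∀ {j i p a c d} → Edge j i → a ∈ E i (b j) → c ∈ E i (b j) → d ∈ E i (b j) →
    a ≢ c → a ≢ d → c ≢ d → Adj p a → Adj p c → Adj p d → p ∈ E i (b j)
  common-neighbour-in-E {p = p} edge a∈ c∈ d∈ a≢c a≢d c≢d pa pc pd with new-or-old p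
  ... | inj₁ (_ , _ , refl) = ⊥-elim (new-vertex-not-adjacent-to-three-of-edge a∈ c∈ d∈ a≢c a≢d c≢d pa pc pd)
  ... | inj₂ old
    with three-positions-contain-rigid-pair (index-distinct a∈ c∈ a≢c) (index-distinct a∈ d∈ a≢d) (index-distinct c∈ d∈ c≢d)
  ... | inj₁ rigid        = neighbour-of-rigid-positions-in-edge edge old a∈ c∈ rigid pa pc
  ... | inj₂ (inj₁ rigid) = neighbour-of-rigid-positions-in-edge edge old a∈ d∈ rigid pa pd
  ... | inj₂ (inj₂ rigid) = neighbour-of-rigid-positions-in-edge edge old c∈ d∈ rigid pc pd

  common-neighbour-in-edge : ∀ {e p a c d} → H e → a ∈ e → c ∈ e → d ∈ e →
    a ≢ c → a ≢ d → c ≢ d → Adj p a → Adj p c → Adj p d → p ∈ e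
  common-neighbour-in-edge (inj₁ (_ , j<t , _ , sⱼ≤i , i<ℓⱼ , refl)) = common-neighbour-in-E (j<t , sⱼ≤i , i<ℓⱼ)
  common-neighbour-in-edge (inj₂ (j , lt , chain)) with chainEdge-block {w j} chain
  ... | _ , refl = common-neighbour-in-block lt

  induced-K5⁻-free : InducedK5MinusFree H
  induced-K5⁻-free v (v-injective , adjacent) =
    let e , e∈H , v₀∈e , v₁∈e , v₂∈e = triangle-in-edge (adj 0F 1F) (adj 0F 2F) (adj 1F 2F)
        apex∈e : ∀ {k} → Adj (v 0F) (v k) → Adj (v 1F) (v k) → Adj (v 2F) (v k) → v k ∈ e
        apex∈e = λ a b c → common-neighbour-in-edge e∈H v₀∈e v₁∈e v₂∈e
                             (distinct λ ()) (distinct λ ()) (distinct λ ()) (adj-sym a) (adj-sym b) (adj-sym c)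
    in e , e∈H , λ { 0F → v₀∈e ; 1F → v₁∈e ; 2F → v₂∈e
                   ; 3F → apex∈e (adj 0F 3F) (adj 1F 3F) (adj 2F 3F)
                   ; 4F → apex∈e (adj 0F 4F) (adj 1F 4F) (adj 2F 4F) }
    where
    adj : ∀ k k′ {k<k′ : True (toℕ k <? toℕ k′)} {k≢3 : False (toℕ k ≟ℕ 3)} → Adj (v k) (v k′)
    adj k k′ {k<k′} {k≢3} = adjacent k k′ (toWitness k<k′) (toWitnessFalse k≢3 ∘ proj₁)
    distinct : ∀ {k k′} → k ≢ k′ → v k ≢ v k′
    distinct k≢k′ = k≢k′ ∘ v-injective

mainTheorem11 : (n t : ℕ) (b b' s ℓ : ℕ → ℕ) (w : ℕ → Fin 11 → V) →
    (∀ i j → i < j → j < t → b i < b j) →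
    (∀ j → j < t → 1 ≤ b j × b j ≤ n) →
    (∀ j → j < t → b j ≡ 10 * b' j) →
    ThreeAPFree t b' →
    EndpointsChosen n t b s ℓ →
    ChainsChosen t b s ℓ w →
    InducedK5MinusFree (H'B t b s ℓ w)
mainTheorem11 _ _ _ _ _ _ _ _ _ b≡10b′ ap-free _ chains = induced-K5⁻-free b≡10b′ ap-free chains
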